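{- Let $G$ be a $P_6$-free graph and let $S\subseteq V(G)$ be a minimal separator in $G$, with $D_1,D_2$ two components of $G-S$ that are full to $S$. Then there exist $A_1\subseteq V(D_1)$ and $A_2\subseteq V(D_2)$ with $|A_1|\leq 3$ and $|A_2|\leq 3$ such that $S\subseteq N[A_1\cup A_2]$.
   Context: Graphs are finite and simple; $P_6$-free means no induced path on $6$ vertices. $N[X]$ denotes the union of closed neighbourhoods of vertices in $X$. A connected component $D$ of $G-S$ is full to $S$ if every vertex of $S$ has a neighbour in $D$; $S$ is a minimal separator if $G-S$ has at least two components full to $S$. -}

module Defs where

open import Data.Nat using (ℕ; suc)
open import Data.Bool using (Bool; true; false)
open import Data.Fin using (Fin; toℕ)
open import Data.Fin.Subset using (Subset; _∈_; _∉_; _⊆_; _∪_; ∁; Nonempty)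
open import Data.Product using (Σ; ∃; ∃-syntax; _×_; _,_)
open import Data.Sum using (_⊎_)
open import Relation.Binary.PropositionalEquality using (_≡_; _≢_)
open import Function.Definitions using (Injective)
open import Relation.Nullary using (¬_)

record Graph (n : ℕ) : Set where
  field
    adj   : Fin n → Fin n → Bool
    sym   : ∀ u v → adj u v ≡ adj v u
    irrfl : ∀ v → adj v v ≡ false

open Graph public

Adj : ∀ {n} → Graph n → Fin n → Fin n → Set
Adj G u v = adj G u v ≡ true

Consec : Fin 6 → Fin 6 → Set
Consec i j = (toℕ j ≡ suc (toℕ i)) ⊎ (toℕ i ≡ suc (toℕ j))

InducedP6 : ∀ {n} → Graph n → (Fin 6 → Fin n) → Set
InducedP6 G f = Injective _≡_ _≡_ f × (∀ i j → (Adj G (f i) (f j) → Consec i j) × (Consec i j → Adj G (f i) (f j)))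

P6Free : ∀ {n} → Graph n → Set
P6Free G = ∀ f → ¬ InducedP6 G f

data Reach {n} (G : Graph n) (X : Subset n) (u : Fin n) : Fin n → Set where
  here : u ∈ X → Reach G X u u
  step : ∀ {w v} → Reach G X u w → Adj G w v → v ∈ X → Reach G X u v

IsComponent : ∀ {n} → Graph n → Subset n → Subset n → Set
IsComponent {n} G S D =
  Nonempty D
  × D ⊆ ∁ S
  × (∀ {u v} → u ∈ D → v ∈ D → Reach G D u v)
  × (∀ {u v} → u ∈ D → v ∉ S → Adj G u v → v ∈ D)

FullTo : ∀ {n} → Graph n → Subset n → Subset n → Set
FullTo G S D = ∀ {s} → s ∈ S → ∃[ d ] (d ∈ D × Adj G s d)

-- S is a minimal separator: G - S has two (distinct) components full to S
IsMinimalSeparator : ∀ {n} → Graph n → Subset n → Set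
IsMinimalSeparator G S =
  ∃[ D₁ ] ∃[ D₂ ] (D₁ ≢ D₂ × IsComponent G S D₁ × IsComponent G S D₂
                   × FullTo G S D₁ × FullTo G S D₂)

N[_]_ : ∀ {n} → Subset n → Graph n → Fin n → Set
(N[ X ] G) v = v ∈ X ⊎ ∃[ x ] (x ∈ X × Adj G x v)

module Submission where

-- We prove the sharper bound |A₁|, |A₂| ≤ 2.  Fix a ∈ D₁ and b ∈ D₂; if every
-- s ∈ S sees a or b we are done, so let r ∈ S see neither.
-- Distance-two lemma: if t ∈ S misses a ∈ D and some b ∈ D' (D, D' distinct full
-- components), then t and a have a common neighbour in D; otherwise a walk in D
-- towards a leaves distance two from t, producing an induced path u–p₁–p₂–t that an
-- edge of D' leaving N(t) extends to an induced P₆.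
-- So candidates exist: pairs (p, q), p ∈ D₁ seeing a and r, q ∈ D₂ seeing b and r.
-- Take one maximising |N(a) ∪ N(p) ∪ N(b) ∪ N(q)|.  A vertex t ∈ S missed by
-- a, p, b, q yields competing candidates (p', q) and (p, q') covering t; maximality
-- yields vertices t₂, t₃ seen only by p resp. q; and this configuration always
-- contains an induced P₆.

open import Defs
open import Data.Nat as ℕ using (ℕ; suc; _+_; _≤_; s≤s; z≤n)
open import Data.Nat.Properties using (≤-trans; ≤-reflexive; <⇒≱; +-monoʳ-≤; n≤1+n; +-suc; m≤n⇒m≤1+n)
open import Data.Bool using (true; false)
open import Data.Bool.Properties using (¬-not) renaming (_≟_ to _≟ᵇ_)
open import Data.Fin as Fin using (Fin; zero; suc; toℕ)
open import Data.Fin.Properties using (all?; any?; <-cmp)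
open import Data.Fin.Subset using (Subset; _∈_; _∉_; _⊆_; _⊂_; _∪_; ∣_∣; ∁; ⁅_⁆)
open import Data.Fin.Subset.Properties
  using (_∈?_; x∈∁p⇒x∉p; ⊆-antisym; x∈⁅x⁆; x∈⁅y⁆⇒x≡y; x∈p∪q⁻; x∈p∪q⁺; ∣⁅x⁆∣≡1; p⊂q⇒∣p∣<∣q∣)
open import Data.Product using (∃-syntax; _×_; _,_; proj₁; proj₂)
open import Data.Sum using (_⊎_; inj₁; inj₂)
open import Data.Empty using (⊥-elim)
open import Data.List using (List; filter; allFin; cartesianProduct)
open import Data.List.Relation.Unary.All using (lookup)
open import Data.List.Relation.Unary.All.Properties using (all-filter)
open import Data.List.Membership.Propositional using () renaming (_∈_ to _∈ₗ_)
open import Data.List.Membership.Propositional.Properties using (∈-filter⁺; ∈-allFin; ∈-cartesianProduct⁺)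
open import Data.List.Extrema.Nat using (argmax; argmax-all; f[xs]≤f[argmax])
open import Data.Vec using ([]; _∷_; tabulate)
open import Data.Vec.Properties using (lookup∘tabulate; lookup⇒[]=; []=⇒lookup)
open import Function using (id; _∘_; case_of_)
open import Relation.Binary.Definitions using (tri<; tri≈; tri>)
open import Relation.Binary.PropositionalEquality
  using (_≡_; _≢_; refl; trans; cong; cong₂; subst) renaming (sym to ≡-sym)
open import Relation.Nullary using (¬_; Dec; does; yes; no)
open import Relation.Nullary.Decidable
  using (_⊎-dec_; _×-dec_; _→-dec_; ¬?; toWitness; dec-true; decidable-stable)
open import Relation.Unary using (Decidable)

-- Induced P₆ certificates

-- Adjacency in the path 0–1–2–3–4–5 is decidable; the three finite facts about it
-- used below are checked by running the decision procedures.
consec? : ∀ i j → Dec (Consec i j)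
consec? i j = (toℕ j ℕ.≟ suc (toℕ i)) ⊎-dec (toℕ i ℕ.≟ suc (toℕ j))

consec-irrefl : ∀ i → does (consec? i i) ≡ false
consec-irrefl = toWitness {a? = all? λ i → does (consec? i i) ≟ᵇ false} _

consec-sym : ∀ i j → does (consec? i j) ≡ does (consec? j i)
consec-sym = toWitness {a? = all? λ i → all? λ j → does (consec? i j) ≟ᵇ does (consec? j i)} _

consec-twins : ∀ i j → (∀ k → does (consec? i k) ≡ does (consec? j k)) → i ≡ j
consec-twins = toWitness {a? = all? λ i → all? λ j →
  all? (λ k → does (consec? i k) ≟ᵇ does (consec? j k)) →-dec (i Fin.≟ j)} _

does-true : ∀ {A : Set} (a? : Dec A) → does a? ≡ true → A
does-true (yes a) _ = a

module Adjacency {n} (G : Graph n) where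

  infix 4 _~_ _≁_

  _~_ : Fin n → Fin n → Set
  x ~ y = adj G x y ≡ true

  _≁_ : Fin n → Fin n → Set
  x ≁ y = adj G x y ≡ false

  adj-sym : ∀ {x y c} → adj G x y ≡ c → adj G y x ≡ c
  adj-sym {x} {y} = trans (sym G y x)

  adjacent? : ∀ x y {X : Set} → (x ~ y → X) → (x ≁ y → X) → X
  adjacent? x y yes-case no-case with adj G x y
  ... | true  = yes-case refl
  ... | false = no-case refl

  ~-≁-absurd : ∀ {x y} {X : Set} → x ~ y → x ≁ y → X
  ~-≁-absurd x~y x≁y with () ← trans (≡-sym x~y) x≁y

  -- f is an induced P₆ as soon as its adjacencies from earlier to later
  -- positions are those of the path; symmetry, irreflexivity and injectivity follow.
  induced-from-upper : (f : Fin 6 → Fin n)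
    → (∀ i j → i Fin.< j → adj G (f i) (f j) ≡ does (consec? i j)) → InducedP6 G f
  induced-from-upper f upper =
    injective , λ i j → (λ e → does-true (consec? i j) (trans (≡-sym (spec i j)) e))
                      , (λ c → trans (spec i j) (dec-true (consec? i j) c))
    where
    spec : ∀ i j → adj G (f i) (f j) ≡ does (consec? i j)
    spec i j with <-cmp i j
    ... | tri< i<j _ _ = upper i j i<j
    ... | tri≈ _ refl _ = trans (irrfl G (f i)) (≡-sym (consec-irrefl i))
    ... | tri> _ _ j<i = trans (sym G (f i) (f j)) (trans (upper j i j<i) (consec-sym j i))
    injective : ∀ {i j} → f i ≡ f j → i ≡ j
    injective {i} {j} fi≡fj = consec-twins i j λ k →
      trans (≡-sym (spec i k)) (trans (cong (λ v → adj G v (f k)) fi≡fj) (spec j k))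

  path : (v₀ v₁ v₂ v₃ v₄ v₅ : Fin n) → Fin 6 → Fin n
  path v₀ v₁ v₂ v₃ v₄ v₅ zero = v₀
  path v₀ v₁ v₂ v₃ v₄ v₅ (suc zero) = v₁
  path v₀ v₁ v₂ v₃ v₄ v₅ (suc (suc zero)) = v₂
  path v₀ v₁ v₂ v₃ v₄ v₅ (suc (suc (suc zero))) = v₃
  path v₀ v₁ v₂ v₃ v₄ v₅ (suc (suc (suc (suc zero)))) = v₄
  path v₀ v₁ v₂ v₃ v₄ v₅ (suc (suc (suc (suc (suc zero))))) = v₅

  no-P6 : P6Free G → ∀ {v₀ v₁ v₂ v₃ v₄ v₅}
    → v₀ ~ v₁ → v₁ ~ v₂ → v₂ ~ v₃ → v₃ ~ v₄ → v₄ ~ v₅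
    → v₀ ≁ v₂ → v₀ ≁ v₃ → v₀ ≁ v₄ → v₀ ≁ v₅ → v₁ ≁ v₃ → v₁ ≁ v₄ → v₁ ≁ v₅
    → v₂ ≁ v₄ → v₂ ≁ v₅ → v₃ ≁ v₅ → ∀ {X : Set} → X
  no-P6 p6 {v₀} {v₁} {v₂} {v₃} {v₄} {v₅} e01 e12 e23 e34 e45 n02 n03 n04 n05 n13 n14 n15 n24 n25 n35 =
    ⊥-elim (p6 f (induced-from-upper f upper))
    where
    f : Fin 6 → Fin n
    f = path v₀ v₁ v₂ v₃ v₄ v₅
    upper : ∀ i j → i Fin.< j → adj G (f i) (f j) ≡ does (consec? i j)
    upper _ zero ()
    upper zero (suc zero) _ = e01
    upper (suc i) (suc zero) (s≤s ())
    upper zero (suc (suc zero)) _ = n02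
    upper (suc zero) (suc (suc zero)) _ = e12
    upper (suc (suc i)) (suc (suc zero)) (s≤s (s≤s ()))
    upper zero (suc (suc (suc zero))) _ = n03
    upper (suc zero) (suc (suc (suc zero))) _ = n13
    upper (suc (suc zero)) (suc (suc (suc zero))) _ = e23
    upper (suc (suc (suc i))) (suc (suc (suc zero))) (s≤s (s≤s (s≤s ())))
    upper zero (suc (suc (suc (suc zero)))) _ = n04
    upper (suc zero) (suc (suc (suc (suc zero)))) _ = n14
    upper (suc (suc zero)) (suc (suc (suc (suc zero)))) _ = n24
    upper (suc (suc (suc zero))) (suc (suc (suc (suc zero)))) _ = e34
    upper (suc (suc (suc (suc i)))) (suc (suc (suc (suc zero)))) (s≤s (s≤s (s≤s (s≤s ()))))
    upper zero (suc (suc (suc (suc (suc zero))))) _ = n05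
    upper (suc zero) (suc (suc (suc (suc (suc zero))))) _ = n15
    upper (suc (suc zero)) (suc (suc (suc (suc (suc zero))))) _ = n25
    upper (suc (suc (suc zero))) (suc (suc (suc (suc (suc zero))))) _ = n35
    upper (suc (suc (suc (suc zero)))) (suc (suc (suc (suc (suc zero))))) _ = e45
    upper (suc (suc (suc (suc (suc i))))) (suc (suc (suc (suc (suc zero))))) (s≤s (s≤s (s≤s (s≤s (s≤s ())))))

-- Components of G - S

reach-end : ∀ {n} {G : Graph n} {X u v} → Reach G X u v → v ∈ X
reach-end (here v∈X) = v∈X
reach-end (step _ _ v∈X) = v∈X

module _ {n} {G : Graph n} {S C : Subset n} (cC : IsComponent G S C) where

  avoids : C ⊆ ∁ S
  avoids = proj₁ (proj₂ cC)

  connected : ∀ {u v} → u ∈ C → v ∈ C → Reach G C u v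
  connected = proj₁ (proj₂ (proj₂ cC))

  closed : ∀ {u v} → u ∈ C → v ∉ S → Adj G u v → v ∈ C
  closed = proj₂ (proj₂ (proj₂ cC))

module _ {n} {G : Graph n} {S : Subset n} where
  open Adjacency G

  walk-stays : ∀ {C X u v} → IsComponent G S C → X ⊆ ∁ S → Reach G X u v → u ∈ C → v ∈ C
  walk-stays _ _ (here _) u∈C = u∈C
  walk-stays cC X⊆∁S (step walk w~v v∈X) u∈C =
    closed cC (walk-stays cC X⊆∁S walk u∈C) (x∈∁p⇒x∉p (X⊆∁S v∈X)) w~v

  components-disjoint : ∀ {C C' x} → C ≢ C' → IsComponent G S C → IsComponent G S C' → x ∈ C → x ∉ C'
  components-disjoint C≢C' cC cC' x∈C x∈C' = C≢C' (⊆-antisym (absorb cC cC' x∈C x∈C') (absorb cC' cC x∈C' x∈C))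
    where
    absorb : ∀ {C C' x} → IsComponent G S C → IsComponent G S C' → x ∈ C → x ∈ C' → C ⊆ C'
    absorb cC cC' x∈C x∈C' y∈C = walk-stays cC' (avoids cC) (connected cC x∈C y∈C) x∈C'

  components-apart : ∀ {C C' x y} → C ≢ C' → IsComponent G S C → IsComponent G S C' → x ∈ C → y ∈ C' → x ≁ y
  components-apart C≢C' cC cC' x∈C y∈C' = adjacent? _ _
    (λ x~y → ⊥-elim (components-disjoint (C≢C' ∘ ≡-sym) cC' cC y∈C'
                       (closed cC x∈C (x∈∁p⇒x∉p (avoids cC' y∈C')) x~y)))
    id

-- The distance-two lemma

module DistanceTwo {n} (G : Graph n) (p6 : P6Free G) {S C C' : Subset n} (C≢C' : C ≢ C')
                   (cC : IsComponent G S C) (cC' : IsComponent G S C')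
                   (fC : FullTo G S C) (fC' : FullTo G S C') where
  open Adjacency G

  apart : ∀ {x y} → x ∈ C → y ∈ C' → x ≁ y
  apart = components-apart C≢C' cC cC'

  -- If t ∈ S ends an induced path u–p₁–p₂–t inside C, then t sees all of C':
  -- an edge w–v of C' with t ~ w and t ≁ v would complete an induced P₆.
  complete-to-C' : ∀ {t u p₁ p₂} → t ∈ S → u ∈ C → p₁ ∈ C → p₂ ∈ C
    → u ~ p₁ → p₁ ~ p₂ → p₂ ~ t → u ≁ p₂ → u ≁ t → p₁ ≁ t → ∀ {y} → y ∈ C' → t ~ y
  complete-to-C' {t} t∈S u∈C p₁∈C p₂∈C u~p₁ p₁~p₂ p₂~t u≁p₂ u≁t p₁≁t y∈C' with fC' t∈S
  ... | y₀ , y₀∈C' , t~y₀ = sees (connected cC' y₀∈C' y∈C')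
    where
    sees : ∀ {v} → Reach G C' y₀ v → t ~ v
    sees (here _) = t~y₀
    sees (step {w} {v} walk w~v v∈C') = adjacent? t v id λ t≁v →
      no-P6 p6 u~p₁ p₁~p₂ p₂~t (sees walk) w~v
        u≁p₂ u≁t (apart u∈C w∈C') (apart u∈C v∈C') p₁≁t (apart p₁∈C w∈C') (apart p₁∈C v∈C')
        (apart p₂∈C w∈C') (apart p₂∈C v∈C') t≁v
      where
      w∈C' : w ∈ C'
      w∈C' = reach-end walk

  Near : Fin n → Fin n → Set
  Near t v = t ~ v ⊎ ∃[ w ] (w ∈ C × t ~ w × w ~ v)

  common? : ∀ t v → Dec (∃[ w ] (w ∈ C × t ~ w × w ~ v))
  common? t v = any? λ w → (w ∈? C) ×-dec (adj G t w ≟ᵇ true) ×-dec (adj G w v ≟ᵇ true)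

  -- If t misses some b ∈ C', nearness to t propagates along the edges of C:
  -- otherwise v–w–w'–t would be an induced path as in complete-to-C'.
  near-step : ∀ {t b w v} → t ∈ S → b ∈ C' → t ≁ b → w ∈ C → Near t w → w ~ v → v ∈ C → Near t v
  near-step {t} {b} {w} {v} t∈S b∈C' t≁b w∈C near w~v v∈C with adjacent? t v inj₁ inj₂ | common? t v
  ... | inj₁ t~v | _ = inj₁ t~v
  ... | inj₂ _ | yes common = inj₂ common
  ... | inj₂ t≁v | no none with near
  ...   | inj₁ t~w = ⊥-elim (none (w , w∈C , t~w , w~v))
  ...   | inj₂ (w' , w'∈C , t~w' , w'~w) =
    adjacent? v w' (λ v~w' → ⊥-elim (none (w' , w'∈C , t~w' , adj-sym v~w'))) λ v≁w' →
    adjacent? w t (λ w~t → ⊥-elim (none (w , w∈C , adj-sym w~t , w~v))) λ w≁t →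
    ~-≁-absurd (complete-to-C' t∈S v∈C w∈C w'∈C (adj-sym w~v) (adj-sym w'~w) (adj-sym t~w')
                                 v≁w' (adj-sym t≁v) w≁t b∈C') t≁b

  near-along : ∀ {t b w₀ v} → t ∈ S → b ∈ C' → t ≁ b → t ~ w₀ → Reach G C w₀ v → Near t v
  near-along t∈S b∈C' t≁b t~w₀ (here _) = inj₁ t~w₀
  near-along t∈S b∈C' t≁b t~w₀ (step walk w~v v∈C) =
    near-step t∈S b∈C' t≁b (reach-end walk) (near-along t∈S b∈C' t≁b t~w₀ walk) w~v v∈C

  common-neighbour : ∀ {t a b} → t ∈ S → a ∈ C → t ≁ a → b ∈ C' → t ≁ b → ∃[ p ] (p ∈ C × a ~ p × p ~ t)
  common-neighbour t∈S a∈C t≁a b∈C' t≁b with fC t∈S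
  ... | w₀ , w₀∈C , t~w₀ with near-along t∈S b∈C' t≁b t~w₀ (connected cC w₀∈C a∈C)
  ...   | inj₁ t~a = ~-≁-absurd t~a t≁a
  ...   | inj₂ (p , p∈C , t~p , p~a) = p , p∈C , adj-sym p~a , adj-sym t~p

-- Two P₆ configurations between vertex sets D₁, D₂ with no edges between them

module Configurations {n} (G : Graph n) (p6 : P6Free G) {D₁ D₂ : Subset n}
                      (apart : ∀ {x y} → x ∈ D₁ → y ∈ D₂ → adj G x y ≡ false) where
  open Adjacency G

  apart' : ∀ {x y} → x ∈ D₂ → y ∈ D₁ → x ≁ y
  apart' x∈D₂ y∈D₁ = adj-sym (apart y∈D₁ x∈D₂)

  reroute : ∀ {a p p' b q r t} → a ∈ D₁ → p ∈ D₁ → p' ∈ D₁ → b ∈ D₂ → q ∈ D₂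
    → a ~ p → p ~ r → b ~ q → q ~ r → r ≁ a → r ≁ b
    → a ≁ t → p ≁ t → b ≁ t → q ≁ t → a ~ p' → p' ~ t → p' ~ r
  reroute {a} {p} {p'} {b} {q} {r} {t} a∈ p∈ p'∈ b∈ q∈ a~p p~r b~q q~r r≁a r≁b a≁t p≁t b≁t q≁t a~p' p'~t =
    adjacent? p' r id λ p'≁r → adjacent? p p'
      (λ p~p' → adjacent? r t
        (λ r~t → no-P6 p6 a~p' p'~t (adj-sym r~t) (adj-sym q~r) (adj-sym b~q)
                   a≁t (adj-sym r≁a) (apart a∈ q∈) (apart a∈ b∈) p'≁r (apart p'∈ q∈) (apart p'∈ b∈)
                   (adj-sym q≁t) (adj-sym b≁t) r≁b)
        (λ r≁t → no-P6 p6 b~q q~r (adj-sym p~r) p~p' p'~t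
                   (adj-sym r≁b) (apart' b∈ p∈) (apart' b∈ p'∈) b≁t (apart' q∈ p∈) (apart' q∈ p'∈) q≁t
                   (adj-sym p'≁r) r≁t p≁t))
      (λ p≁p' → no-P6 p6 b~q q~r (adj-sym p~r) (adj-sym a~p) a~p'
                  (adj-sym r≁b) (apart' b∈ p∈) (apart' b∈ a∈) (apart' b∈ p'∈) (apart' q∈ p∈) (apart' q∈ a∈)
                  (apart' q∈ p'∈) r≁a (adj-sym p'≁r) p≁p')

  no-undominated : ∀ {a p p' b q q' t t₂ t₃} → a ∈ D₁ → p ∈ D₁ → p' ∈ D₁ → b ∈ D₂ → q ∈ D₂ → q' ∈ D₂
    → a ~ p → a ~ p' → b ~ q → b ~ q'
    → a ≁ t → p ≁ t → b ≁ t → q ≁ t → p' ~ t → q' ~ t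
    → p ~ t₂ → a ≁ t₂ → p' ≁ t₂ → b ≁ t₂ → q ≁ t₂
    → q ~ t₃ → a ≁ t₃ → p ≁ t₃ → b ≁ t₃ → q' ≁ t₃ → ∀ {X : Set} → X
  no-undominated {a} {p} {p'} {b} {q} {q'} {t} {t₂} {t₃} a∈ p∈ p'∈ b∈ q∈ q'∈ a~p a~p' b~q b~q'
                 a≁t p≁t b≁t q≁t p'~t q'~t p~t₂ a≁t₂ p'≁t₂ b≁t₂ q≁t₂ q~t₃ a≁t₃ p≁t₃ b≁t₃ q'≁t₃ =
    adjacent? p p'
      (λ p~p' → adjacent? q q'
        (λ q~q' → adjacent? t₂ t₃
          (λ t₂~t₃ → no-P6 p6 a~p p~t₂ t₂~t₃ (adj-sym q~t₃) (adj-sym b~q)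
                       a≁t₂ a≁t₃ (apart a∈ q∈) (apart a∈ b∈) p≁t₃ (apart p∈ q∈) (apart p∈ b∈)
                       (adj-sym q≁t₂) (adj-sym b≁t₂) (adj-sym b≁t₃))
          (λ t₂≁t₃ → adjacent? p' t₃
            (λ p'~t₃ → no-P6 p6 b~q q~t₃ (adj-sym p'~t₃) (adj-sym p~p') p~t₂
                         b≁t₃ (apart' b∈ p'∈) (apart' b∈ p∈) b≁t₂ (apart' q∈ p'∈) (apart' q∈ p∈) q≁t₂
                         (adj-sym p≁t₃) (adj-sym t₂≁t₃) p'≁t₂)
            (λ p'≁t₃ → adjacent? t t₃
              (λ t~t₃ → no-P6 p6 a~p' p'~t t~t₃ (adj-sym q~t₃) (adj-sym b~q)
                          a≁t a≁t₃ (apart a∈ q∈) (apart a∈ b∈) p'≁t₃ (apart p'∈ q∈) (apart p'∈ b∈)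
                          (adj-sym q≁t) (adj-sym b≁t) (adj-sym b≁t₃))
              (λ t≁t₃ → no-P6 p6 a~p' p'~t (adj-sym q'~t) (adj-sym q~q') q~t₃
                          a≁t (apart a∈ q'∈) (apart a∈ q∈) a≁t₃ (apart p'∈ q'∈) (apart p'∈ q∈) p'≁t₃
                          (adj-sym q≁t) t≁t₃ q'≁t₃))))
        (λ q≁q' → no-P6 p6 a~p' p'~t (adj-sym q'~t) (adj-sym b~q') b~q
                    a≁t (apart a∈ q'∈) (apart a∈ b∈) (apart a∈ q∈) (apart p'∈ q'∈) (apart p'∈ b∈) (apart p'∈ q∈)
                    (adj-sym b≁t) (adj-sym q≁t) (adj-sym q≁q')))
      (λ p≁p' → no-P6 p6 b~q' q'~t (adj-sym p'~t) (adj-sym a~p') a~p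
                  b≁t (apart' b∈ p'∈) (apart' b∈ a∈) (apart' b∈ p∈) (apart' q'∈ p'∈) (apart' q'∈ a∈) (apart' q'∈ p∈)
                  (adj-sym a≁t) (adj-sym p≁t) (adj-sym p≁p'))

-- Finite sets: comprehension, cardinality, maximisation

module _ {n} {P : Fin n → Set} (P? : Decidable P) where

  select : Subset n
  select = tabulate (does ∘ P?)

  select⁺ : ∀ {x} → P x → x ∈ select
  select⁺ {x} px = lookup⇒[]= x select (trans (lookup∘tabulate (does ∘ P?) x) (dec-true (P? x) px))

  select⁻ : ∀ {x} → x ∈ select → P x
  select⁻ {x} x∈ = does-true (P? x) (trans (≡-sym (lookup∘tabulate (does ∘ P?) x)) ([]=⇒lookup x∈))

private-element : ∀ {n} {X Y : Subset n} {t} → ∣ Y ∣ ≤ ∣ X ∣ → t ∈ Y → t ∉ X → ∃[ s ] (s ∈ X × s ∉ Y)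
private-element {X = X} {Y} {t} ∣Y∣≤∣X∣ t∈Y t∉X with any? (λ s → (s ∈? X) ×-dec ¬? (s ∈? Y))
... | yes found = found
... | no none = ⊥-elim (<⇒≱ (p⊂q⇒∣p∣<∣q∣ X⊂Y) ∣Y∣≤∣X∣)
  where
  X⊂Y : X ⊂ Y
  X⊂Y = (λ {s} s∈X → decidable-stable (s ∈? Y) λ s∉Y → none (s , s∈X , s∉Y)) , t , t∈Y , t∉X

∣p∪q∣≤∣p∣+∣q∣ : ∀ {n} (p q : Subset n) → ∣ p ∪ q ∣ ≤ ∣ p ∣ + ∣ q ∣
∣p∪q∣≤∣p∣+∣q∣ [] [] = z≤n
∣p∪q∣≤∣p∣+∣q∣ (true ∷ p) (true ∷ q) = s≤s (≤-trans (∣p∪q∣≤∣p∣+∣q∣ p q) (+-monoʳ-≤ ∣ p ∣ (n≤1+n ∣ q ∣)))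
∣p∪q∣≤∣p∣+∣q∣ (true ∷ p) (false ∷ q) = s≤s (∣p∪q∣≤∣p∣+∣q∣ p q)
∣p∪q∣≤∣p∣+∣q∣ (false ∷ p) (true ∷ q) = subst (suc ∣ p ∪ q ∣ ≤_) (≡-sym (+-suc ∣ p ∣ ∣ q ∣)) (s≤s (∣p∪q∣≤∣p∣+∣q∣ p q))
∣p∪q∣≤∣p∣+∣q∣ (false ∷ p) (false ∷ q) = ∣p∪q∣≤∣p∣+∣q∣ p q

pair : ∀ {n} → Fin n → Fin n → Subset n
pair x y = ⁅ x ⁆ ∪ ⁅ y ⁆

∣pair∣≤2 : ∀ {n} (x y : Fin n) → ∣ pair x y ∣ ≤ 2
∣pair∣≤2 x y = ≤-trans (∣p∪q∣≤∣p∣+∣q∣ ⁅ x ⁆ ⁅ y ⁆) (≤-reflexive (cong₂ _+_ (∣⁅x⁆∣≡1 x) (∣⁅x⁆∣≡1 y)))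

pair-⊆ : ∀ {n} {D : Subset n} {x y} → x ∈ D → y ∈ D → pair x y ⊆ D
pair-⊆ {D = D} {x} {y} x∈D y∈D z∈ with x∈p∪q⁻ ⁅ x ⁆ ⁅ y ⁆ z∈
... | inj₁ z∈⁅x⁆ = subst (_∈ D) (≡-sym (x∈⁅y⁆⇒x≡y x z∈⁅x⁆)) x∈D
... | inj₂ z∈⁅y⁆ = subst (_∈ D) (≡-sym (x∈⁅y⁆⇒x≡y y z∈⁅y⁆)) y∈D

first∈pair : ∀ {n} (x y : Fin n) → x ∈ pair x y
first∈pair x y = x∈p∪q⁺ (inj₁ (x∈⁅x⁆ x))

second∈pair : ∀ {n} (x y : Fin n) → y ∈ pair x y
second∈pair x y = x∈p∪q⁺ {p = ⁅ x ⁆} (inj₂ (x∈⁅x⁆ y))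

maximise : ∀ {A : Set} {P : A → Set} → Decidable P → (score : A → ℕ) (xs : List A) → (∀ x → x ∈ₗ xs)
  → ∃[ x ] P x → ∃[ m ] (P m × ∀ {y} → P y → score y ≤ score m)
maximise {A} P? score xs enumerates (x₀ , Px₀) =
  argmax score x₀ candidates , argmax-all score Px₀ (all-filter P? xs)
  , λ {y} Py → lookup (f[xs]≤f[argmax] {f = score} x₀ candidates) (∈-filter⁺ P? (enumerates y) Py)
  where
  candidates : List A
  candidates = filter P? xs

pairs : ∀ n → List (Fin n × Fin n)
pairs n = cartesianProduct (allFin n) (allFin n)

∈-pairs : ∀ {n} (x : Fin n × Fin n) → x ∈ₗ pairs n
∈-pairs (p , q) = ∈-cartesianProduct⁺ (∈-allFin p) (∈-allFin q)

module Domination {n} (G : Graph n) (p6 : P6Free G) (S D₁ D₂ : Subset n) (D₁≢D₂ : D₁ ≢ D₂)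
                  (c₁ : IsComponent G S D₁) (c₂ : IsComponent G S D₂)
                  (f₁ : FullTo G S D₁) (f₂ : FullTo G S D₂) where
  open Adjacency G
  open DistanceTwo G p6 D₁≢D₂ c₁ c₂ f₁ f₂ using () renaming (common-neighbour to common-neighbour₁)
  open DistanceTwo G p6 (D₁≢D₂ ∘ ≡-sym) c₂ c₁ f₂ f₁ using () renaming (common-neighbour to common-neighbour₂)
  open Configurations G p6 (components-apart D₁≢D₂ c₁ c₂) using (no-undominated) renaming (reroute to reroute₁)
  open Configurations G p6 (components-apart (D₁≢D₂ ∘ ≡-sym) c₂ c₁) using () renaming (reroute to reroute₂)

  Conclusion : Set
  Conclusion = ∃[ A₁ ] ∃[ A₂ ] (A₁ ⊆ D₁ × A₂ ⊆ D₂ × ∣ A₁ ∣ ≤ 3 × ∣ A₂ ∣ ≤ 3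
                               × (∀ {s} → s ∈ S → (N[ A₁ ∪ A₂ ] G) s))

  Dominated : (a p b q s : Fin n) → Set
  Dominated a p b q s = a ~ s ⊎ p ~ s ⊎ b ~ s ⊎ q ~ s

  dominated? : ∀ a p b q → Decidable (Dominated a p b q)
  dominated? a p b q s =
    (adj G a s ≟ᵇ true) ⊎-dec (adj G p s ≟ᵇ true) ⊎-dec (adj G b s ≟ᵇ true) ⊎-dec (adj G q s ≟ᵇ true)

  undominated : ∀ {a p b q s} → ¬ Dominated a p b q s → a ≁ s × p ≁ s × b ≁ s × q ≁ s
  undominated ¬dom = ¬-not (¬dom ∘ inj₁) , ¬-not (¬dom ∘ inj₂ ∘ inj₁)
                   , ¬-not (¬dom ∘ inj₂ ∘ inj₂ ∘ inj₁) , ¬-not (¬dom ∘ inj₂ ∘ inj₂ ∘ inj₂)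

  conclude : ∀ {a p b q} → a ∈ D₁ → p ∈ D₁ → b ∈ D₂ → q ∈ D₂
    → (∀ {s} → s ∈ S → Dominated a p b q s) → Conclusion
  conclude {a} {p} {b} {q} a∈ p∈ b∈ q∈ dominates =
    pair a p , pair b q , pair-⊆ a∈ p∈ , pair-⊆ b∈ q∈
    , m≤n⇒m≤1+n (∣pair∣≤2 a p) , m≤n⇒m≤1+n (∣pair∣≤2 b q) , inj₂ ∘ dominator ∘ dominates
    where
    in₁ : ∀ {x} → x ∈ pair a p → x ∈ pair a p ∪ pair b q
    in₁ x∈ = x∈p∪q⁺ (inj₁ x∈)
    in₂ : ∀ {x} → x ∈ pair b q → x ∈ pair a p ∪ pair b q
    in₂ x∈ = x∈p∪q⁺ {p = pair a p} (inj₂ x∈)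
    dominator : ∀ {s} → Dominated a p b q s → ∃[ x ] (x ∈ pair a p ∪ pair b q × x ~ s)
    dominator (inj₁ a~s) = a , in₁ (first∈pair a p) , a~s
    dominator (inj₂ (inj₁ p~s)) = p , in₁ (second∈pair a p) , p~s
    dominator (inj₂ (inj₂ (inj₁ b~s))) = b , in₂ (first∈pair b q) , b~s
    dominator (inj₂ (inj₂ (inj₂ q~s))) = q , in₂ (second∈pair b q) , q~s

  module AroundR {a b r} (a∈ : a ∈ D₁) (b∈ : b ∈ D₂) (r∈S : r ∈ S) (r≁a : r ≁ a) (r≁b : r ≁ b) where

    Candidate : Fin n × Fin n → Set
    Candidate (p , q) = p ∈ D₁ × q ∈ D₂ × a ~ p × p ~ r × b ~ q × q ~ r

    candidate? : Decidable Candidate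
    candidate? (p , q) = (p ∈? D₁) ×-dec (q ∈? D₂) ×-dec (adj G a p ≟ᵇ true) ×-dec (adj G p r ≟ᵇ true)
                         ×-dec (adj G b q ≟ᵇ true) ×-dec (adj G q r ≟ᵇ true)

    covered : Fin n × Fin n → Subset n
    covered (p , q) = select (dominated? a p b q)

    some-candidate : ∃[ pq ] Candidate pq
    some-candidate with common-neighbour₁ r∈S a∈ r≁a b∈ r≁b | common-neighbour₂ r∈S b∈ r≁b a∈ r≁a
    ... | p , p∈ , a~p , p~r | q , q∈ , b~q , q~r = (p , q) , p∈ , q∈ , a~p , p~r , b~q , q~r

    best : ∃[ pq ] (Candidate pq × ∀ {pq'} → Candidate pq' → ∣ covered pq' ∣ ≤ ∣ covered pq ∣)
    best = maximise candidate? (∣_∣ ∘ covered) (pairs n) ∈-pairs some-candidate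

    p q : Fin n
    p = proj₁ (proj₁ best)
    q = proj₂ (proj₁ best)

    best-candidate : Candidate (p , q)
    best-candidate = proj₁ (proj₂ best)

    maximal : ∀ {pq'} → Candidate pq' → ∣ covered pq' ∣ ≤ ∣ covered (p , q) ∣
    maximal = proj₂ (proj₂ best)

    exchange : ∀ {p' q' t} → Candidate (p' , q') → Dominated a p' b q' t → ¬ Dominated a p b q t
      → ∃[ s ] (Dominated a p b q s × ¬ Dominated a p' b q' s)
    exchange {p'} {q'} cand' dom' ¬dom =
      let s , s∈ , s∉ = private-element (maximal cand')
                          (select⁺ (dominated? a p' b q') dom') (¬dom ∘ select⁻ (dominated? a p b q))
      in s , select⁻ (dominated? a p b q) s∈ , s∉ ∘ select⁺ (dominated? a p' b q')

    only-p : ∀ {s} → Dominated a p b q s → a ≁ s → b ≁ s → q ≁ s → p ~ s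
    only-p (inj₁ a~s) a≁s _ _ = ~-≁-absurd a~s a≁s
    only-p (inj₂ (inj₁ p~s)) _ _ _ = p~s
    only-p (inj₂ (inj₂ (inj₁ b~s))) _ b≁s _ = ~-≁-absurd b~s b≁s
    only-p (inj₂ (inj₂ (inj₂ q~s))) _ _ q≁s = ~-≁-absurd q~s q≁s

    only-q : ∀ {s} → Dominated a p b q s → a ≁ s → p ≁ s → b ≁ s → q ~ s
    only-q (inj₁ a~s) a≁s _ _ = ~-≁-absurd a~s a≁s
    only-q (inj₂ (inj₁ p~s)) _ p≁s _ = ~-≁-absurd p~s p≁s
    only-q (inj₂ (inj₂ (inj₁ b~s))) _ _ b≁s = ~-≁-absurd b~s b≁s
    only-q (inj₂ (inj₂ (inj₂ q~s))) _ _ _ = q~s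

    -- A missed t
    -- yields candidates (p', q) and (p, q') covering t, hence by maximality vertices
    -- t₂, t₃ seen only by p resp. q, which is the forbidden configuration.
    no-missed : ∀ {t} → t ∈ S → ¬ ¬ Dominated a p b q t
    no-missed {t} t∈S ¬dom =
      let a≁t , p≁t , b≁t , q≁t = undominated ¬dom
          p∈ , q∈ , a~p , p~r , b~q , q~r = best-candidate
          p' , p'∈ , a~p' , p'~t = common-neighbour₁ t∈S a∈ (adj-sym a≁t) b∈ (adj-sym b≁t)
          q' , q'∈ , b~q' , q'~t = common-neighbour₂ t∈S b∈ (adj-sym b≁t) a∈ (adj-sym a≁t)
          p'~r = reroute₁ a∈ p∈ p'∈ b∈ q∈ a~p p~r b~q q~r r≁a r≁b a≁t p≁t b≁t q≁t a~p' p'~t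
          q'~r = reroute₂ b∈ q∈ q'∈ a∈ p∈ b~q q~r a~p p~r r≁b r≁a b≁t q≁t a≁t p≁t b~q' q'~t
          t₂ , dom₂ , ¬dom₂ = exchange (p'∈ , q∈ , a~p' , p'~r , b~q , q~r) (inj₂ (inj₁ p'~t)) ¬dom
          t₃ , dom₃ , ¬dom₃ = exchange (p∈ , q'∈ , a~p , p~r , b~q' , q'~r) (inj₂ (inj₂ (inj₂ q'~t))) ¬dom
          a≁t₂ , p'≁t₂ , b≁t₂ , q≁t₂ = undominated ¬dom₂
          a≁t₃ , p≁t₃ , b≁t₃ , q'≁t₃ = undominated ¬dom₃
      in no-undominated a∈ p∈ p'∈ b∈ q∈ q'∈ a~p a~p' b~q b~q' a≁t p≁t b≁t q≁t p'~t q'~t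
           (only-p dom₂ a≁t₂ b≁t₂ q≁t₂) a≁t₂ p'≁t₂ b≁t₂ q≁t₂
           (only-q dom₃ a≁t₃ p≁t₃ b≁t₃) a≁t₃ p≁t₃ b≁t₃ q'≁t₃

    conclusion : Conclusion
    conclusion = let p∈ , q∈ , _ = best-candidate in
      conclude a∈ p∈ b∈ q∈ λ t∈S → decidable-stable (dominated? a p b q _) (no-missed t∈S)

  missed-by-both? : ∀ a b → Dec (∃[ r ] (r ∈ S × r ≁ a × r ≁ b))
  missed-by-both? a b = any? λ r → (r ∈? S) ×-dec (adj G r a ≟ᵇ false) ×-dec (adj G r b ≟ᵇ false)

  seen-by-a-or-b : ∀ {a b} → a ∈ D₁ → b ∈ D₂ → ¬ (∃[ r ] (r ∈ S × r ≁ a × r ≁ b)) → Conclusion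
  seen-by-a-or-b {a} {b} a∈ b∈ none = conclude a∈ a∈ b∈ b∈ λ {s} s∈S →
    adjacent? a s inj₁ λ a≁s → adjacent? b s (inj₂ ∘ inj₂ ∘ inj₁) λ b≁s →
    ⊥-elim (none (s , s∈S , adj-sym a≁s , adj-sym b≁s))

lemma3p5 : ∀ {n} (G : Graph n) → P6Free G → (S : Subset n) → IsMinimalSeparator G S
    → (D₁ D₂ : Subset n) → D₁ ≢ D₂
    → IsComponent G S D₁ → IsComponent G S D₂ → FullTo G S D₁ → FullTo G S D₂
    → ∃[ A₁ ] ∃[ A₂ ] (A₁ ⊆ D₁ × A₂ ⊆ D₂ × ∣ A₁ ∣ ≤ 3 × ∣ A₂ ∣ ≤ 3
    × (∀ {s} → s ∈ S → (N[ A₁ ∪ A₂ ] G) s))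
lemma3p5 G p6 S _ D₁ D₂ D₁≢D₂ c₁ c₂ f₁ f₂ =
  let a , a∈ = proj₁ c₁
      b , b∈ = proj₁ c₂
  in case missed-by-both? a b of λ where
       (yes (r , r∈S , r≁a , r≁b)) → AroundR.conclusion a∈ b∈ r∈S r≁a r≁b
       (no none) → seen-by-a-or-b a∈ b∈ none
  where open Domination G p6 S D₁ D₂ D₁≢D₂ c₁ c₂ f₁ f₂
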